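{- Let $r\ge 2$ and $n$ be integers. If $n\ge \frac{5}{2}r$, then the diameter of $H_{n:r}$ is $4$. If $2r+1\le n<\frac{5}{2}r$, then the diameter of $H_{n:r}$ equals $\max\left\{5,\left\lceil\frac{r-1}{n-2r}\right\rceil+1\right\}$.
   Context: For positive integers $n,r$ write $[n]=\{1,\dots,n\}$. The Häggkvist–Hell graph $H_{n:r}$ is the graph whose vertices are the ordered pairs $(h,T)$ where $T$ is an $r$-element subset of $[n]$ and $h\in[n]\setminus T$ ($h$ is called the head and $T$ the tail); two vertices $(h_x,T_x)$ and $(h_y,T_y)$ are adjacent iff $h_x\in T_y$, $h_y\in T_x$ and $T_x\cap T_y=\varnothing$. The diameter is the maximum graph distance between two vertices. -}

module Defs where

open import Data.Nat using (ℕ; zero; suc; _+_; _≤_)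
open import Data.Nat.DivMod using (_/_)
open import Data.Fin using (Fin)
open import Data.Fin.Subset using (Subset; _∈_; _∉_; _∩_; ∣_∣; Empty)
open import Data.Product using (_×_; Σ; ∃; _,_)
open import Relation.Binary.PropositionalEquality using (_≡_)

-- Raw pairs (head , tail); 'IsVertex n r' carves out the vertex set of H_{n:r}.
Pair : ℕ → Set
Pair n = Fin n × Subset n

IsVertex : (n r : ℕ) → Pair n → Set
IsVertex n r (h , T) = ∣ T ∣ ≡ r × h ∉ T

Adj : {n : ℕ} → Pair n → Pair n → Set
Adj (hx , Tx) (hy , Ty) = hx ∈ Ty × hy ∈ Tx × Empty (Tx ∩ Ty)

data Walk (n r : ℕ) : Pair n → Pair n → ℕ → Set where
  nil  : ∀ {x} → Walk n r x x 0
  cons : ∀ {x y z k} → Adj x y → IsVertex n r y → Walk n r y z k → Walk n r x z (suc k)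

DistLe : (n r : ℕ) → Pair n → Pair n → ℕ → Set
DistLe n r x y k = Σ ℕ λ j → j ≤ k × Walk n r x y j

Diameter : (n r d : ℕ) → Set
Diameter n r d =
  (∀ x y → IsVertex n r x → IsVertex n r y → DistLe n r x y d) ×
  ∃ λ x → ∃ λ y → IsVertex n r x × IsVertex n r y × (∀ k → Walk n r x y k → d ≤ k)

-- ceiling division ⌈a / b⌉ for b ≥ 1 (junk value 0 for b = 0).
ceilDiv : ℕ → ℕ → ℕ
ceilDiv a zero = 0
ceilDiv a (suc b) = (a + b) / suc b

-- Write n = 2r + d and compare the tails W, U of two vertices through their difference
-- t = ∣ W ─ U ∣ and overlap s = ∣ W ∩ U ∣ = r - t.
--
-- Adjacent tails are disjoint, so one step bounds the overlap with a fixed tail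
-- U by the next difference, and the difference by d plus the next overlap.  Hence a walk of
-- length 2j forces t ≤ j d and one of length 2j + 1 forces s ≤ j d (the parity invariant);
-- together with a direct look at walks of length ≤ 3, vertices with a common head and a
-- suitable overlap are far apart.
--
-- If t ≤ min(d, r - 1) and each head avoids the other tail, the two vertices have
-- a common neighbour.  Interpolating a tail between W and U yields distance ≤ 4 for t ≤ 2d, and
-- every further two steps reduce t by d: distance ≤ 2k when t ≤ k d.  One preliminary step
-- towards U turns s ≤ k d into a difference bound, giving distance ≤ 2k + 1.
--
-- For r ≤ 2d this gives diameter 4.  For 2d < r let q = ⌈(r - 1)/d⌉: every pair has
-- t ≤ ⌈q/2⌉ d or s ≤ ⌊q/2⌋ d, so distances are at most max(5, q + 1), and a common head with
-- disjoint tails (q ≤ 4) or with overlap (⌈q/2⌉ - 1) d + 1 (q ≥ 5) attains this bound.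

module Submission where

open import Defs
open import Data.Nat using (ℕ; zero; suc; _+_; _*_; _∸_; _≤_; _<_; _⊔_; z≤n; s≤s; _≤?_; ⌊_/2⌋; ⌈_/2⌉)
open import Data.Nat.DivMod using (_%_; m≡m%n+[m/n]*n; m%n<n)
open import Data.Nat.Properties
open import Data.Fin using (Fin)
import Data.Fin as Fin
open import Data.Fin.Subset
open import Data.Fin.Subset.Properties
open import Data.Vec using ([]; _∷_)
open import Data.Vec.Base using (here; there)
open import Data.Bool using (true; false)
open import Data.Product using (_×_; Σ; ∃; _,_; proj₁; proj₂)
open import Data.Sum using (_⊎_; inj₁; inj₂; [_,_]′)
import Data.Sum as Sum
open import Data.Empty using (⊥-elim)
open import Relation.Nullary using (Dec; yes; no)
open import Relation.Binary.PropositionalEquality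
open import Data.Nat.Tactic.RingSolver using (solve-∀)

x∈p─q⇒x∉q : ∀ {n} {x : Fin n} (p q : Subset n) → x ∈ p ─ q → x ∉ q
x∈p─q⇒x∉q (true ∷ p) (false ∷ q) here ()
x∈p─q⇒x∉q (b ∷ p) (true ∷ q) (there x∈p─q) (there x∈q) = x∈p─q⇒x∉q p q x∈p─q x∈q
x∈p─q⇒x∉q (b ∷ p) (false ∷ q) (there x∈p─q) (there x∈q) = x∈p─q⇒x∉q p q x∈p─q x∈q

x∉p∪q : ∀ {n} {x : Fin n} {p q : Subset n} → x ∉ p → x ∉ q → x ∉ p ∪ q
x∉p∪q {p = p} {q} x∉p x∉q x∈p∪q = [ x∉p , x∉q ]′ (x∈p∪q⁻ p q x∈p∪q)

∉∪⇒∉ˡ : ∀ {n} {x : Fin n} {p q : Subset n} → x ∉ p ∪ q → x ∉ p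
∉∪⇒∉ˡ {q = q} x∉p∪q x∈p = x∉p∪q (p⊆p∪q q x∈p)

∉∪⇒∉ʳ : ∀ {n} {x : Fin n} {p q : Subset n} → x ∉ p ∪ q → x ∉ q
∉∪⇒∉ʳ {p = p} {q} x∉p∪q x∈q = x∉p∪q (q⊆p∪q p q x∈q)

∉∪⇒∈∁ : ∀ {n} {x : Fin n} {p q : Subset n} → x ∉ p → x ∉ q → x ∈ ∁ (p ∪ q)
∉∪⇒∈∁ x∉p x∉q = x∉p⇒x∈∁p (x∉p∪q x∉p x∉q)

∈∁∪⇒∉ˡ : ∀ {n} {x : Fin n} {p q : Subset n} → x ∈ ∁ (p ∪ q) → x ∉ p
∈∁∪⇒∉ˡ {q = q} x∈∁ x∈p = x∈∁p⇒x∉p x∈∁ (p⊆p∪q q x∈p)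

∈∁∪⇒∉ʳ : ∀ {n} {x : Fin n} {p q : Subset n} → x ∈ ∁ (p ∪ q) → x ∉ q
∈∁∪⇒∉ʳ {p = p} {q} x∈∁ x∈q = x∈∁p⇒x∉p x∈∁ (q⊆p∪q p q x∈q)

⁅x⁆⊆ : ∀ {n} {x : Fin n} {A : Subset n} → x ∈ A → ⁅ x ⁆ ⊆ A
⁅x⁆⊆ {x = x} {A} x∈A y∈⁅x⁆ = subst (_∈ A) (sym (x∈⁅y⁆⇒x≡y x y∈⁅x⁆)) x∈A

∪⊆ : ∀ {n} {p q A : Subset n} → p ⊆ A → q ⊆ A → p ∪ q ⊆ A
∪⊆ {p = p} {q} p⊆A q⊆A x∈p∪q = [ p⊆A , q⊆A ]′ (x∈p∪q⁻ p q x∈p∪q)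

p⊆⁅x⁆∪[p-x] : ∀ {n} (p : Subset n) (x : Fin n) → p ⊆ ⁅ x ⁆ ∪ (p - x)
p⊆⁅x⁆∪[p-x] p x {y} y∈p with y Fin.≟ x
... | yes refl = p⊆p∪q (p - x) (x∈⁅x⁆ x)
... | no y≢x = q⊆p∪q ⁅ x ⁆ (p - x) (x∈p∧x≢y⇒x∈p-y y∈p y≢x)

∣p∣≡∣p∩q∣+∣p─q∣ : ∀ {n} (p q : Subset n) → ∣ p ∣ ≡ ∣ p ∩ q ∣ + ∣ p ─ q ∣
∣p∣≡∣p∩q∣+∣p─q∣ [] [] = refl
∣p∣≡∣p∩q∣+∣p─q∣ (true ∷ p) (true ∷ q) = cong suc (∣p∣≡∣p∩q∣+∣p─q∣ p q)
∣p∣≡∣p∩q∣+∣p─q∣ (true ∷ p) (false ∷ q) = trans (cong suc (∣p∣≡∣p∩q∣+∣p─q∣ p q)) (sym (+-suc _ _))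
∣p∣≡∣p∩q∣+∣p─q∣ (false ∷ p) (true ∷ q) = ∣p∣≡∣p∩q∣+∣p─q∣ p q
∣p∣≡∣p∩q∣+∣p─q∣ (false ∷ p) (false ∷ q) = ∣p∣≡∣p∩q∣+∣p─q∣ p q

∣p∪q∣+∣p∩q∣≡∣p∣+∣q∣ : ∀ {n} (p q : Subset n) → ∣ p ∪ q ∣ + ∣ p ∩ q ∣ ≡ ∣ p ∣ + ∣ q ∣
∣p∪q∣+∣p∩q∣≡∣p∣+∣q∣ [] [] = refl
∣p∪q∣+∣p∩q∣≡∣p∣+∣q∣ (true ∷ p) (true ∷ q) =
  cong suc (trans (+-suc _ _) (trans (cong suc (∣p∪q∣+∣p∩q∣≡∣p∣+∣q∣ p q)) (sym (+-suc _ _))))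
∣p∪q∣+∣p∩q∣≡∣p∣+∣q∣ (true ∷ p) (false ∷ q) = cong suc (∣p∪q∣+∣p∩q∣≡∣p∣+∣q∣ p q)
∣p∪q∣+∣p∩q∣≡∣p∣+∣q∣ (false ∷ p) (true ∷ q) =
  trans (cong suc (∣p∪q∣+∣p∩q∣≡∣p∣+∣q∣ p q)) (sym (+-suc _ _))
∣p∪q∣+∣p∩q∣≡∣p∣+∣q∣ (false ∷ p) (false ∷ q) = ∣p∪q∣+∣p∩q∣≡∣p∣+∣q∣ p q

∣p∪q∣≤∣p∣+∣q∣ : ∀ {n} (p q : Subset n) → ∣ p ∪ q ∣ ≤ ∣ p ∣ + ∣ q ∣
∣p∪q∣≤∣p∣+∣q∣ p q = subst (∣ p ∪ q ∣ ≤_) (∣p∪q∣+∣p∩q∣≡∣p∣+∣q∣ p q) (m≤m+n _ _)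

∣p∣+∣∁p∣≡n : ∀ {n} (p : Subset n) → ∣ p ∣ + ∣ ∁ p ∣ ≡ n
∣p∣+∣∁p∣≡n [] = refl
∣p∣+∣∁p∣≡n (true ∷ p) = cong suc (∣p∣+∣∁p∣≡n p)
∣p∣+∣∁p∣≡n (false ∷ p) = trans (+-suc _ _) (cong suc (∣p∣+∣∁p∣≡n p))

∣p─p∣≡0 : ∀ {n} (p : Subset n) → ∣ p ─ p ∣ ≡ 0
∣p─p∣≡0 [] = refl
∣p─p∣≡0 (true ∷ p) = ∣p─p∣≡0 p
∣p─p∣≡0 (false ∷ p) = ∣p─p∣≡0 p

Empty⇒∣p∣≡0 : ∀ {n} {p : Subset n} → Empty p → ∣ p ∣ ≡ 0
Empty⇒∣p∣≡0 {n} empty = trans (cong ∣_∣ (Empty-unique empty)) (∣⊥∣≡0 n)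

x∈p⇒1≤∣p∣ : ∀ {n} {x : Fin n} {p : Subset n} → x ∈ p → 1 ≤ ∣ p ∣
x∈p⇒1≤∣p∣ {x = x} {p} x∈p = subst (_≤ ∣ p ∣) (∣⁅x⁆∣≡1 x) (p⊆q⇒∣p∣≤∣q∣ (⁅x⁆⊆ x∈p))

∣p∣≡0⇒Empty : ∀ {n} {p : Subset n} → ∣ p ∣ ≡ 0 → Empty p
∣p∣≡0⇒Empty ∣p∣≡0 (_ , x∈p) with subst (1 ≤_) ∣p∣≡0 (x∈p⇒1≤∣p∣ x∈p)
... | ()

∣p∪q∣≡∣p∣+∣q∣ : ∀ {n} (p q : Subset n) → Empty (p ∩ q) → ∣ p ∪ q ∣ ≡ ∣ p ∣ + ∣ q ∣
∣p∪q∣≡∣p∣+∣q∣ p q disjoint = begin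
  ∣ p ∪ q ∣               ≡⟨ +-identityʳ _ ⟨
  ∣ p ∪ q ∣ + 0           ≡⟨ cong (∣ p ∪ q ∣ +_) (Empty⇒∣p∣≡0 disjoint) ⟨
  ∣ p ∪ q ∣ + ∣ p ∩ q ∣   ≡⟨ ∣p∪q∣+∣p∩q∣≡∣p∣+∣q∣ p q ⟩
  ∣ p ∣ + ∣ q ∣           ∎
  where open ≡-Reasoning

∣p∪q∣≡∣p∣+∣q─p∣ : ∀ {n} (p q : Subset n) → ∣ p ∪ q ∣ ≡ ∣ p ∣ + ∣ q ─ p ∣
∣p∪q∣≡∣p∣+∣q─p∣ p q = +-cancelʳ-≡ ∣ p ∩ q ∣ _ _ (begin
  ∣ p ∪ q ∣ + ∣ p ∩ q ∣           ≡⟨ ∣p∪q∣+∣p∩q∣≡∣p∣+∣q∣ p q ⟩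
  ∣ p ∣ + ∣ q ∣                   ≡⟨ cong (∣ p ∣ +_) (∣p∣≡∣p∩q∣+∣p─q∣ q p) ⟩
  ∣ p ∣ + (∣ q ∩ p ∣ + ∣ q ─ p ∣) ≡⟨ cong (λ s → ∣ p ∣ + (∣ s ∣ + ∣ q ─ p ∣)) (∩-comm q p) ⟩
  ∣ p ∣ + (∣ p ∩ q ∣ + ∣ q ─ p ∣) ≡⟨ cong (∣ p ∣ +_) (+-comm ∣ p ∩ q ∣ _) ⟩
  ∣ p ∣ + (∣ q ─ p ∣ + ∣ p ∩ q ∣) ≡⟨ +-assoc ∣ p ∣ _ _ ⟨
  ∣ p ∣ + ∣ q ─ p ∣ + ∣ p ∩ q ∣   ∎)
  where open ≡-Reasoning

∣q─p∣≡∣p─q∣ : ∀ {n} (p q : Subset n) → ∣ p ∣ ≡ ∣ q ∣ → ∣ q ─ p ∣ ≡ ∣ p ─ q ∣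
∣q─p∣≡∣p─q∣ p q ∣p∣≡∣q∣ = +-cancelˡ-≡ ∣ p ∩ q ∣ _ _ (begin
  ∣ p ∩ q ∣ + ∣ q ─ p ∣   ≡⟨ cong (λ s → ∣ s ∣ + ∣ q ─ p ∣) (∩-comm p q) ⟩
  ∣ q ∩ p ∣ + ∣ q ─ p ∣   ≡⟨ ∣p∣≡∣p∩q∣+∣p─q∣ q p ⟨
  ∣ q ∣                   ≡⟨ ∣p∣≡∣q∣ ⟨
  ∣ p ∣                   ≡⟨ ∣p∣≡∣p∩q∣+∣p─q∣ p q ⟩
  ∣ p ∩ q ∣ + ∣ p ─ q ∣   ∎)
  where open ≡-Reasoning

∣p∣≤1+∣p-x∣ : ∀ {n} (p : Subset n) (x : Fin n) → ∣ p ∣ ≤ 1 + ∣ p - x ∣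
∣p∣≤1+∣p-x∣ p x = ≤-trans (p⊆q⇒∣p∣≤∣q∣ (p⊆⁅x⁆∪[p-x] p x))
  (≤-trans (∣p∪q∣≤∣p∣+∣q∣ ⁅ x ⁆ (p - x)) (≤-reflexive (cong (_+ ∣ p - x ∣) (∣⁅x⁆∣≡1 x))))

∣A─U∣+∣Q∣≤∣A∣ : ∀ {n} {A U Q : Subset n} → Q ⊆ A ∩ U → ∣ A ─ U ∣ + ∣ Q ∣ ≤ ∣ A ∣
∣A─U∣+∣Q∣≤∣A∣ {A = A} {U} {Q} Q⊆A∩U = begin
  ∣ A ─ U ∣ + ∣ Q ∣       ≤⟨ +-monoʳ-≤ ∣ A ─ U ∣ (p⊆q⇒∣p∣≤∣q∣ Q⊆A∩U) ⟩
  ∣ A ─ U ∣ + ∣ A ∩ U ∣   ≡⟨ +-comm ∣ A ─ U ∣ _ ⟩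
  ∣ A ∩ U ∣ + ∣ A ─ U ∣   ≡⟨ ∣p∣≡∣p∩q∣+∣p─q∣ A U ⟨
  ∣ A ∣                   ∎
  where open ≤-Reasoning

nonempty : ∀ {n} (p : Subset n) → 1 ≤ ∣ p ∣ → Nonempty p
nonempty (true ∷ p) _ = Fin.zero , here
nonempty (false ∷ p) 1≤∣p∣ with nonempty p 1≤∣p∣
... | x , x∈p = Fin.suc x , there x∈p

missing : ∀ {n} (p : Subset n) → ∣ p ∣ < n → ∃ λ x → x ∉ p
missing {n} p ∣p∣<n with nonempty (∁ p) (+-cancelˡ-≤ ∣ p ∣ 1 _ 1+∣p∣≤∣p∣+∣∁p∣)
  where
  1+∣p∣≤∣p∣+∣∁p∣ : ∣ p ∣ + 1 ≤ ∣ p ∣ + ∣ ∁ p ∣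
  1+∣p∣≤∣p∣+∣∁p∣ = subst₂ _≤_ (+-comm 1 ∣ p ∣) (sym (∣p∣+∣∁p∣≡n p)) ∣p∣<n
... | x , x∈∁p = x , x∈∁p⇒x∉p x∈∁p

record Chosen {n} (R A : Subset n) (m : ℕ) : Set where
  field
    set  : Subset n
    R⊆   : R ⊆ set
    ⊆A   : set ⊆ A
    size : ∣ set ∣ ≡ m

choose : ∀ {n} (A : Subset n) (m : ℕ) → m ≤ ∣ A ∣ → Chosen ⊥ A m
choose [] zero _ = record { set = [] ; R⊆ = λ () ; ⊆A = λ () ; size = refl }
choose {suc n} (true ∷ A) zero _ = record { set = ⊥ ; R⊆ = λ x∈⊥ → x∈⊥ ; ⊆A = ⊥⊆ ; size = ∣⊥∣≡0 (suc n) }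
choose (true ∷ A) (suc m) (s≤s m≤∣A∣) = record
  { set = true ∷ set ; R⊆ = ⊥⊆ ; ⊆A = s⊆s ⊆A ; size = cong suc size }
  where open Chosen (choose A m m≤∣A∣)
choose (false ∷ A) m m≤∣A∣ = record
  { set = false ∷ set ; R⊆ = ⊥⊆ ; ⊆A = out⊆ ⊆A ; size = size }
  where open Chosen (choose A m m≤∣A∣)

-- Any size between ∣ R ∣ and ∣ A ∣ is realised by a set between R and A: add to R a subset
-- of A ─ R of the missing size.
chooseAround : ∀ {n} (R A : Subset n) (m : ℕ) → R ⊆ A → ∣ R ∣ ≤ m → m ≤ ∣ A ∣ → Chosen R A m
chooseAround R A m R⊆A ∣R∣≤m m≤∣A∣ = record
  { set = R ∪ S ; R⊆ = p⊆p∪q S ; ⊆A = ∪⊆ R⊆A (λ x∈S → p─q⊆p A R (S⊆A─R x∈S)) ; size = ∣R∪S∣≡m }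
  where
  ∣A∩R∣≡∣R∣ : ∣ A ∩ R ∣ ≡ ∣ R ∣
  ∣A∩R∣≡∣R∣ = ≤-antisym (∣p∩q∣≤∣q∣ A R) (p⊆q⇒∣p∣≤∣q∣ (λ x∈R → x∈p∩q⁺ (R⊆A x∈R , x∈R)))
  room : m ∸ ∣ R ∣ ≤ ∣ A ─ R ∣
  room = subst (m ∸ ∣ R ∣ ≤_)
    (trans (cong (_∸ ∣ R ∣) (trans (∣p∣≡∣p∩q∣+∣p─q∣ A R) (cong (_+ ∣ A ─ R ∣) ∣A∩R∣≡∣R∣)))
           (m+n∸m≡n ∣ R ∣ _))
    (∸-monoˡ-≤ ∣ R ∣ m≤∣A∣)
  open Chosen (choose (A ─ R) (m ∸ ∣ R ∣) room) renaming (set to S; ⊆A to S⊆A─R; size to ∣S∣)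
  R∩S-empty : Empty (R ∩ S)
  R∩S-empty (_ , x∈R∩S) =
    x∈p─q⇒x∉q A R (S⊆A─R (proj₂ (x∈p∩q⁻ R S x∈R∩S))) (proj₁ (x∈p∩q⁻ R S x∈R∩S))
  ∣R∪S∣≡m : ∣ R ∪ S ∣ ≡ m
  ∣R∪S∣≡m = trans (∣p∪q∣≡∣p∣+∣q∣ R S R∩S-empty) (trans (cong (∣ R ∣ +_) ∣S∣) (m+[n∸m]≡n ∣R∣≤m))

parity : ∀ m → (∃ λ j → m ≡ j + j) ⊎ (∃ λ j → m ≡ suc (j + j))
parity zero = inj₁ (0 , refl)
parity (suc m) with parity m
... | inj₁ (j , m≡j+j) = inj₂ (j , cong suc m≡j+j)
... | inj₂ (j , m≡1+j+j) = inj₁ (suc j , cong suc (trans m≡1+j+j (sym (+-suc j j))))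

⌈n/2⌉≤1+⌊n/2⌋ : ∀ m → ⌈ m /2⌉ ≤ suc ⌊ m /2⌋
⌈n/2⌉≤1+⌊n/2⌋ zero = z≤n
⌈n/2⌉≤1+⌊n/2⌋ (suc zero) = s≤s z≤n
⌈n/2⌉≤1+⌊n/2⌋ (suc (suc m)) = s≤s (⌈n/2⌉≤1+⌊n/2⌋ m)

d≤k*d : ∀ {k} d → 1 ≤ k → d ≤ k * d
d≤k*d {suc k} d _ = m≤m+n d (k * d)

ceilDiv-upper : ∀ a d → 1 ≤ d → a ≤ ceilDiv a d * d
ceilDiv-upper a (suc d) _ = +-cancelʳ-≤ d a (q * suc d) (begin
  a + d                   ≡⟨ m≡m%n+[m/n]*n (a + d) (suc d) ⟩
  (a + d) % suc d + q * suc d   ≤⟨ +-monoˡ-≤ (q * suc d) (≤-pred (m%n<n (a + d) (suc d))) ⟩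
  d + q * suc d           ≡⟨ +-comm d (q * suc d) ⟩
  q * suc d + d           ∎)
  where
  open ≤-Reasoning
  q : ℕ
  q = ceilDiv a (suc d)

ceilDiv-lower : ∀ a d → 1 ≤ d → ceilDiv a d * d < a + d
ceilDiv-lower a (suc d) _ = begin-strict
  q * suc d                     ≤⟨ m≤n+m (q * suc d) ((a + d) % suc d) ⟩
  (a + d) % suc d + q * suc d   ≡⟨ m≡m%n+[m/n]*n (a + d) (suc d) ⟨
  a + d                         <⟨ +-monoʳ-< a (n<1+n d) ⟩
  a + suc d                     ∎
  where
  open ≤-Reasoning
  q : ℕ
  q = ceilDiv a (suc d)

-- Halving q: ⌊q/2⌋ + ⌈q/2⌉ = q with ⌊q/2⌋ ≤ ⌈q/2⌉ ≤ ⌊q/2⌋ + 1.  The distances used for the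
-- middle range are 2 max(2, ⌈q/2⌉), 2 max(2, ⌊q/2⌋) + 1 and max(5, q + 1).
2⌈q/2⌉≤q+1 : ∀ q → 2 * ⌈ q /2⌉ ≤ q + 1
2⌈q/2⌉≤q+1 q = begin
  2 * ⌈ q /2⌉               ≡⟨ cong (⌈ q /2⌉ +_) (+-identityʳ ⌈ q /2⌉) ⟩
  ⌈ q /2⌉ + ⌈ q /2⌉         ≤⟨ +-monoˡ-≤ ⌈ q /2⌉ (⌈n/2⌉≤1+⌊n/2⌋ q) ⟩
  suc ⌊ q /2⌋ + ⌈ q /2⌉     ≡⟨ cong suc (⌊n/2⌋+⌈n/2⌉≡n q) ⟩
  suc q                     ≡⟨ +-comm 1 q ⟩
  q + 1                     ∎
  where open ≤-Reasoning

1+2⌊q/2⌋≤q+1 : ∀ q → suc (2 * ⌊ q /2⌋) ≤ q + 1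
1+2⌊q/2⌋≤q+1 q = begin
  suc (2 * ⌊ q /2⌋)             ≡⟨ cong (λ m → suc (⌊ q /2⌋ + m)) (+-identityʳ ⌊ q /2⌋) ⟩
  suc (⌊ q /2⌋ + ⌊ q /2⌋)       ≤⟨ s≤s (+-monoʳ-≤ ⌊ q /2⌋ (⌊n/2⌋≤⌈n/2⌉ q)) ⟩
  suc (⌊ q /2⌋ + ⌈ q /2⌉)       ≡⟨ cong suc (⌊n/2⌋+⌈n/2⌉≡n q) ⟩
  suc q                         ≡⟨ +-comm 1 q ⟩
  q + 1                         ∎
  where open ≤-Reasoning

evenLength : ∀ q → 2 * (2 ⊔ ⌈ q /2⌉) ≤ 5 ⊔ (q + 1)
evenLength q = ≤-trans (≤-reflexive (*-distribˡ-⊔ 2 2 ⌈ q /2⌉)) (⊔-mono-≤ (n≤1+n 4) (2⌈q/2⌉≤q+1 q))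

oddLength : ∀ q → suc (2 * (2 ⊔ ⌊ q /2⌋)) ≤ 5 ⊔ (q + 1)
oddLength q = ≤-trans (s≤s (≤-reflexive (*-distribˡ-⊔ 2 2 ⌊ q /2⌋))) (⊔-mono-≤ ≤-refl (1+2⌊q/2⌋≤q+1 q))

evenOrOdd : ∀ q d s t → s + t ≤ q * d + 1 → t ≤ ⌈ q /2⌉ * d ⊎ s ≤ ⌊ q /2⌋ * d
evenOrOdd q d s t s+t≤ with t ≤? ⌈ q /2⌉ * d
... | yes t≤ed = inj₁ t≤ed
... | no t≰ed = inj₂ (+-cancelʳ-≤ (e * d + 1) s (o * d) (begin
  s + (e * d + 1)       ≤⟨ +-monoʳ-≤ s (subst (_≤ t) (+-comm 1 (e * d)) (≰⇒> t≰ed)) ⟩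
  s + t                 ≤⟨ s+t≤ ⟩
  q * d + 1             ≡⟨ cong (λ m → m * d + 1) (⌊n/2⌋+⌈n/2⌉≡n q) ⟨
  (o + e) * d + 1       ≡⟨ rearrange o e d ⟩
  o * d + (e * d + 1)   ∎))
  where
  open ≤-Reasoning
  e : ℕ
  e = ⌈ q /2⌉
  o : ℕ
  o = ⌊ q /2⌋
  rearrange : ∀ o e d → (o + e) * d + 1 ≡ o * d + (e * d + 1)
  rearrange = solve-∀

-- The lengths forced on walks between the extremal pair of the middle range.
lowerLengths : ∀ q a → ⌈ q /2⌉ ≡ suc a → q + 1 ≤ suc ⌊ q /2⌋ + suc ⌊ q /2⌋ × q + 1 ≤ suc (suc a + suc a)
lowerLengths q a e≡1+a = even , odd
  where
  open ≤-Reasoning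
  q≡o+e : q ≡ ⌊ q /2⌋ + ⌈ q /2⌉
  q≡o+e = sym (⌊n/2⌋+⌈n/2⌉≡n q)
  even : q + 1 ≤ suc ⌊ q /2⌋ + suc ⌊ q /2⌋
  even = begin
    q + 1                         ≡⟨ cong (_+ 1) q≡o+e ⟩
    ⌊ q /2⌋ + ⌈ q /2⌉ + 1         ≤⟨ +-monoˡ-≤ 1 (+-monoʳ-≤ ⌊ q /2⌋ (⌈n/2⌉≤1+⌊n/2⌋ q)) ⟩
    ⌊ q /2⌋ + suc ⌊ q /2⌋ + 1     ≡⟨ +-comm _ 1 ⟩
    suc ⌊ q /2⌋ + suc ⌊ q /2⌋     ∎
  odd : q + 1 ≤ suc (suc a + suc a)
  odd = begin
    q + 1                         ≡⟨ trans (cong (_+ 1) q≡o+e) (+-comm _ 1) ⟩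
    suc (⌊ q /2⌋ + ⌈ q /2⌉)       ≤⟨ s≤s (+-monoˡ-≤ ⌈ q /2⌉ (⌊n/2⌋≤⌈n/2⌉ q)) ⟩
    suc (⌈ q /2⌉ + ⌈ q /2⌉)       ≡⟨ cong (λ m → suc (m + m)) e≡1+a ⟩
    suc (suc a + suc a)           ∎

-- Room for the extremal overlap: from q d < (r - 1) + d with q = o + (a + 1) one gets
-- o d + (a d + 1) < r.
overlapRoom : ∀ o a d r → 1 ≤ r → (o + suc a) * d < (r ∸ 1) + d → o * d + (a * d + 1) < r
overlapRoom o a d r 1≤r qd< = begin-strict
  o * d + (a * d + 1)   ≡⟨ rearrange o a d ⟩
  suc (o * d + a * d)   <⟨ s≤s (+-cancelʳ-< d (o * d + a * d) (r ∸ 1) (subst (_< r ∸ 1 + d) (expand o a d) qd<)) ⟩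
  suc (r ∸ 1)           ≡⟨ m+[n∸m]≡n 1≤r ⟩
  r                     ∎
  where
  open ≤-Reasoning
  rearrange : ∀ o a d → o * d + (a * d + 1) ≡ suc (o * d + a * d)
  rearrange = solve-∀
  expand : ∀ o a d → (o + suc a) * d ≡ o * d + a * d + d
  expand = solve-∀

-- Writing n = 2r + d with d = n - 2r, the two ranges of the theorem become r ≤ 2d and
-- 1 ≤ d, 2d < r; in these terms 2n = 2d + 4r and 5r = r + 4r.
n≡r+r+[n∸2r] : ∀ n r → 2 * r ≤ n → n ≡ r + r + (n ∸ 2 * r)
n≡r+r+[n∸2r] n r 2r≤n = trans (sym (m+[n∸m]≡n 2r≤n)) (cong (λ m → r + m + (n ∸ 2 * r)) (+-identityʳ r))

2n≡2d+4r : ∀ n r → 2 * r ≤ n → 2 * n ≡ (n ∸ 2 * r) + (n ∸ 2 * r) + 4 * r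
2n≡2d+4r n r 2r≤n = trans (cong (2 *_) (n≡r+r+[n∸2r] n r 2r≤n)) (double r (n ∸ 2 * r))
  where
  double : ∀ r d → 2 * (r + r + d) ≡ d + d + 4 * r
  double = solve-∀

5r≡r+4r : ∀ r → 5 * r ≡ r + 4 * r
5r≡r+4r = solve-∀

large-range : ∀ n r → 5 * r ≤ 2 * n → 2 * r ≤ n × r ≤ (n ∸ 2 * r) + (n ∸ 2 * r)
large-range n r 5r≤2n = 2r≤n , +-cancelʳ-≤ (4 * r) r (d + d) (begin
  r + 4 * r             ≡⟨ 5r≡r+4r r ⟨
  5 * r                 ≤⟨ 5r≤2n ⟩
  2 * n                 ≡⟨ 2n≡2d+4r n r 2r≤n ⟩
  d + d + 4 * r         ∎)
  where
  open ≤-Reasoning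
  d : ℕ
  d = n ∸ 2 * r
  4r+r≡5r : ∀ r → 2 * (2 * r) + r ≡ 5 * r
  4r+r≡5r = solve-∀
  2r≤n : 2 * r ≤ n
  2r≤n = *-cancelˡ-≤ 2 (≤-trans (subst (2 * (2 * r) ≤_) (4r+r≡5r r) (m≤m+n _ r)) 5r≤2n)

middle-range : ∀ n r → 2 * r + 1 ≤ n → 2 * n < 5 * r →
               2 * r ≤ n × 1 ≤ n ∸ 2 * r × (n ∸ 2 * r) + (n ∸ 2 * r) < r
middle-range n r 2r+1≤n 2n<5r = 2r≤n , 1≤d , +-cancelʳ-≤ (4 * r) (suc (d + d)) r (begin
  suc (d + d + 4 * r)   ≡⟨ cong suc (2n≡2d+4r n r 2r≤n) ⟨
  suc (2 * n)           ≤⟨ 2n<5r ⟩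
  5 * r                 ≡⟨ 5r≡r+4r r ⟩
  r + 4 * r             ∎)
  where
  open ≤-Reasoning
  d : ℕ
  d = n ∸ 2 * r
  2r≤n : 2 * r ≤ n
  2r≤n = ≤-trans (m≤m+n (2 * r) 1) 2r+1≤n
  1≤d : 1 ≤ d
  1≤d = subst (_≤ d) (m+n∸m≡n (2 * r) 1) (∸-monoˡ-≤ (2 * r) 2r+1≤n)

_++ʷ_ : ∀ {n r x y z a b} → Walk n r x y a → Walk n r y z b → Walk n r x z (a + b)
nil ++ʷ walk = walk
cons adj v walk ++ʷ walk' = cons adj v (walk ++ʷ walk')

DistLe-weaken : ∀ {n r x y k k'} → k ≤ k' → DistLe n r x y k → DistLe n r x y k'
DistLe-weaken k≤k' (j , j≤k , walk) = j , ≤-trans j≤k k≤k' , walk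

DistLe-prepend : ∀ {n r x y z a k} → Walk n r x y a → DistLe n r y z k → DistLe n r x z (a + k)
DistLe-prepend {a = a} walk (j , j≤k , walk') = a + j , +-monoʳ-≤ a j≤k , walk ++ʷ walk'

sameHeadFar : ∀ {n r h T U k} → 1 ≤ r → IsVertex n r (h , T) → IsVertex n r (h , U) →
              Empty (T ∩ U) → Walk n r (h , T) (h , U) k → 4 ≤ k
sameHeadFar {T = T} 1≤r (∣T∣ , _) _ T∩U=∅ nil with nonempty T (subst (1 ≤_) (sym ∣T∣) 1≤r)
... | x , x∈T = ⊥-elim (T∩U=∅ (x , x∈p∩q⁺ (x∈T , x∈T)))
sameHeadFar _ _ (_ , h∉U) _ (cons (h∈U , _) _ nil) = ⊥-elim (h∉U h∈U)
sameHeadFar _ _ _ T∩U=∅ (cons (_ , a∈T , _) _ (cons (a∈U , _) _ nil)) =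
  ⊥-elim (T∩U=∅ (_ , x∈p∩q⁺ (a∈T , a∈U)))
sameHeadFar _ _ _ _ (cons (h∈A , _) _ (cons (_ , _ , A∩B=∅) _ (cons (_ , h∈B , _) _ nil))) =
  ⊥-elim (A∩B=∅ (_ , x∈p∩q⁺ (h∈A , h∈B)))
sameHeadFar _ _ _ _ (cons _ _ (cons _ _ (cons _ _ (cons _ _ _)))) = s≤s (s≤s (s≤s (s≤s z≤n)))

∣W∩U∣≤∣W'─U∣ : ∀ {n} {W W' U : Subset n} → Empty (W ∩ W') → ∣ W' ∣ ≡ ∣ U ∣ → ∣ W ∩ U ∣ ≤ ∣ W' ─ U ∣
∣W∩U∣≤∣W'─U∣ {W = W} {W'} {U} W∩W'=∅ ∣W'∣≡∣U∣ =
  ≤-trans (p⊆q⇒∣p∣≤∣q∣ W∩U⊆U─W') (≤-reflexive (∣q─p∣≡∣p─q∣ W' U ∣W'∣≡∣U∣))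
  where
  W∩U⊆U─W' : W ∩ U ⊆ U ─ W'
  W∩U⊆U─W' x∈W∩U with x∈p∩q⁻ W U x∈W∩U
  ... | x∈W , x∈U = x∈p∧x∉q⇒x∈p─q x∈U (λ x∈W' → W∩W'=∅ (_ , x∈p∩q⁺ (x∈W , x∈W')))

module Graph (r d : ℕ) where

  n : ℕ
  n = r + r + d

  V : Pair n → Set
  V = IsVertex n r

  ∣∁X∣≡r+d : ∀ (X : Subset n) → ∣ X ∣ ≡ r → ∣ ∁ X ∣ ≡ r + d
  ∣∁X∣≡r+d X ∣X∣ = +-cancelˡ-≡ r _ _ (begin
    r + ∣ ∁ X ∣       ≡⟨ cong (_+ ∣ ∁ X ∣) ∣X∣ ⟨
    ∣ X ∣ + ∣ ∁ X ∣   ≡⟨ ∣p∣+∣∁p∣≡n X ⟩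
    r + r + d         ≡⟨ +-assoc r r d ⟩
    r + (r + d)       ∎)
    where open ≡-Reasoning

  r≤∣∁X∣ : ∀ (X : Subset n) → ∣ X ∣ ≤ r + d → r ≤ ∣ ∁ X ∣
  r≤∣∁X∣ X ∣X∣≤r+d = +-cancelˡ-≤ ∣ X ∣ r _ (begin
    ∣ X ∣ + r         ≤⟨ +-monoˡ-≤ r ∣X∣≤r+d ⟩
    r + d + r         ≡⟨ +-comm (r + d) r ⟩
    r + (r + d)       ≡⟨ +-assoc r r d ⟨
    r + r + d         ≡⟨ ∣p∣+∣∁p∣≡n X ⟨
    ∣ X ∣ + ∣ ∁ X ∣   ∎)
    where open ≤-Reasoning

  -- Along an edge (W disjoint from W') the difference of W from a tail U exceeds the
  -- overlap of W' with U by at most d: W and U ─ W' both lie in ∁ W', of size r + d.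
  ∣W─U∣≤d+∣W'∩U∣ : ∀ {W W' U : Subset n} → Empty (W ∩ W') → ∣ W ∣ ≡ r → ∣ W' ∣ ≡ r → ∣ U ∣ ≡ r →
                   ∣ W ─ U ∣ ≤ d + ∣ W' ∩ U ∣
  ∣W─U∣≤d+∣W'∩U∣ {W} {W'} {U} W∩W'=∅ ∣W∣ ∣W'∣ ∣U∣ = +-cancelʳ-≤ ∣ W ∩ U ∣ _ _ (begin
    ∣ W ─ U ∣ + ∣ W ∩ U ∣               ≡⟨ +-comm ∣ W ─ U ∣ _ ⟩
    ∣ W ∩ U ∣ + ∣ W ─ U ∣               ≡⟨ ∣p∣≡∣p∩q∣+∣p─q∣ W U ⟨
    ∣ W ∣                               ≡⟨ trans ∣W∣ (sym ∣U∣) ⟩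
    ∣ U ∣                               ≡⟨ ∣p∣≡∣p∩q∣+∣p─q∣ U W' ⟩
    ∣ U ∩ W' ∣ + ∣ Z ∣                  ≤⟨ +-mono-≤ (≤-reflexive (cong ∣_∣ (∩-comm U W'))) ∣Z∣≤d+∣W∩U∣ ⟩
    ∣ W' ∩ U ∣ + (d + ∣ W ∩ U ∣)        ≡⟨ +-assoc ∣ W' ∩ U ∣ d _ ⟨
    ∣ W' ∩ U ∣ + d + ∣ W ∩ U ∣          ≡⟨ cong (_+ ∣ W ∩ U ∣) (+-comm ∣ W' ∩ U ∣ d) ⟩
    d + ∣ W' ∩ U ∣ + ∣ W ∩ U ∣          ∎)
    where
    open ≤-Reasoning
    Z : Subset n
    Z = U ─ W'
    W∪Z⊆∁W' : W ∪ Z ⊆ ∁ W'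
    W∪Z⊆∁W' x∈W∪Z with x∈p∪q⁻ W Z x∈W∪Z
    ... | inj₁ x∈W = x∉p⇒x∈∁p (λ x∈W' → W∩W'=∅ (_ , x∈p∩q⁺ (x∈W , x∈W')))
    ... | inj₂ x∈Z = x∉p⇒x∈∁p (x∈p─q⇒x∉q U W' x∈Z)
    W∩Z⊆W∩U : W ∩ Z ⊆ W ∩ U
    W∩Z⊆W∩U x∈W∩Z with x∈p∩q⁻ W Z x∈W∩Z
    ... | x∈W , x∈Z = x∈p∩q⁺ (x∈W , p─q⊆p U W' x∈Z)
    ∣Z∣≤d+∣W∩U∣ : ∣ Z ∣ ≤ d + ∣ W ∩ U ∣
    ∣Z∣≤d+∣W∩U∣ = +-cancelˡ-≤ r _ _ (begin
      r + ∣ Z ∣                  ≡⟨ cong (_+ ∣ Z ∣) ∣W∣ ⟨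
      ∣ W ∣ + ∣ Z ∣              ≡⟨ ∣p∪q∣+∣p∩q∣≡∣p∣+∣q∣ W Z ⟨
      ∣ W ∪ Z ∣ + ∣ W ∩ Z ∣      ≤⟨ +-mono-≤ (≤-trans (p⊆q⇒∣p∣≤∣q∣ W∪Z⊆∁W') (≤-reflexive (∣∁X∣≡r+d W' ∣W'∣)))
                                              (p⊆q⇒∣p∣≤∣q∣ W∩Z⊆W∩U) ⟩
      r + d + ∣ W ∩ U ∣          ≡⟨ +-assoc r d _ ⟩
      r + (d + ∣ W ∩ U ∣)        ∎)

  evenWalkBound : ∀ {g k W U} j → ∣ W ∣ ≡ r → ∣ U ∣ ≡ r → Walk n r (g , W) (k , U) (j + j) → ∣ W ─ U ∣ ≤ j * d
  oddWalkBound : ∀ {g k W U} j → ∣ U ∣ ≡ r → Walk n r (g , W) (k , U) (suc (j + j)) → ∣ W ∩ U ∣ ≤ j * d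

  evenWalkBound {W = W} zero _ _ nil = ≤-reflexive (∣p─p∣≡0 W)
  evenWalkBound (suc j) ∣W∣ ∣U∣ (cons (_ , _ , W∩W'=∅) (∣W'∣ , _) walk) =
    ≤-trans (∣W─U∣≤d+∣W'∩U∣ W∩W'=∅ ∣W∣ ∣W'∣ ∣U∣)
            (+-monoʳ-≤ d (oddWalkBound j ∣U∣ (subst (Walk n r _ _) (+-suc j j) walk)))
  oddWalkBound j ∣U∣ (cons (_ , _ , W∩W'=∅) (∣W'∣ , _) walk) =
    ≤-trans (∣W∩U∣≤∣W'─U∣ W∩W'=∅ (trans ∣W'∣ (sym ∣U∣))) (evenWalkBound j ∣W'∣ ∣U∣ walk)

  walkLength≥ : ∀ {g k T U L} m a b → ∣ T ∣ ≡ r → ∣ U ∣ ≡ r → b * d < ∣ T ─ U ∣ → a * d < ∣ T ∩ U ∣ →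
                m ≤ suc b + suc b → m ≤ suc (suc a + suc a) → Walk n r (g , T) (k , U) L → m ≤ L
  walkLength≥ {L = L} m a b ∣T∣ ∣U∣ bd<t ad<s m≤even m≤odd walk with parity L
  ... | inj₁ (j , refl) = ≤-trans m≤even (+-mono-≤ b<j b<j)
    where
    b<j : b < j
    b<j = *-cancelʳ-< d b j (<-≤-trans bd<t (evenWalkBound j ∣T∣ ∣U∣ walk))
  ... | inj₂ (j , refl) = ≤-trans m≤odd (s≤s (+-mono-≤ a<j a<j))
    where
    a<j : a < j
    a<j = *-cancelʳ-< d a j (<-≤-trans ad<s (oddWalkBound j ∣U∣ walk))

  record SameHeadPair (s : ℕ) : Set where
    field
      head    : Fin n
      tail₁   : Subset n
      tail₂   : Subset n
      vertex₁ : V (head , tail₁)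
      vertex₂ : V (head , tail₂)
      shared  : ∣ tail₁ ∩ tail₂ ∣ ≡ s

  -- Such pairs exist for every s ≤ r once n > 2r: take a tail T avoiding h, keep s of its
  -- elements and fill up with elements outside ⁅ h ⁆ ∪ T.
  sameHeadPair : 1 ≤ d → ∀ s → s ≤ r → SameHeadPair s
  sameHeadPair 1≤d s s≤r = record
    { head = h ; tail₁ = T ; tail₂ = U ; vertex₁ = ∣T∣ , h∉T ; vertex₂ = ∣U∣ , h∉U ; shared = ∣T∩U∣≡s }
    where
    h : Fin n
    h = Fin.fromℕ< (≤-trans 1≤d (m≤n+m d (r + r)))
    1+r≤r+d : 1 + r ≤ r + d
    1+r≤r+d = subst (_≤ r + d) (+-comm r 1) (+-monoʳ-≤ r 1≤d)
    open Chosen (choose (∁ ⁅ h ⁆) r (r≤∣∁X∣ ⁅ h ⁆ (≤-trans (≤-reflexive (∣⁅x⁆∣≡1 h)) (≤-trans (m≤m+n 1 r) 1+r≤r+d))))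
      using () renaming (set to T; ⊆A to T⊆∁h; size to ∣T∣)
    open Chosen (choose T s (subst (s ≤_) (sym ∣T∣) s≤r))
      using () renaming (set to K; ⊆A to K⊆T; size to ∣K∣)
    Far : Subset n
    Far = ∁ (⁅ h ⁆ ∪ T)
    r≤∣Far∣ : r ≤ ∣ Far ∣
    r≤∣Far∣ = r≤∣∁X∣ (⁅ h ⁆ ∪ T) (≤-trans (∣p∪q∣≤∣p∣+∣q∣ ⁅ h ⁆ T) (≤-trans (≤-reflexive (cong₂ _+_ (∣⁅x⁆∣≡1 h) ∣T∣)) 1+r≤r+d))
    open Chosen (chooseAround K (K ∪ Far) r (p⊆p∪q Far) (≤-trans (≤-reflexive ∣K∣) s≤r)
                              (≤-trans r≤∣Far∣ (∣q∣≤∣p∪q∣ K Far)))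
      using () renaming (set to U; R⊆ to K⊆U; ⊆A to U⊆K∪Far; size to ∣U∣)
    h∉T : h ∉ T
    h∉T h∈T = x∈∁p⇒x∉p (T⊆∁h h∈T) (x∈⁅x⁆ h)
    h∉U : h ∉ U
    h∉U h∈U = [ (λ h∈K → h∉T (K⊆T h∈K)) , (λ h∈Far → ∈∁∪⇒∉ˡ h∈Far (x∈⁅x⁆ h)) ]′
                (x∈p∪q⁻ K Far (U⊆K∪Far h∈U))
    T∩U⊆K : T ∩ U ⊆ K
    T∩U⊆K x∈T∩U = [ (λ x∈K → x∈K) , (λ x∈Far → ⊥-elim (∈∁∪⇒∉ʳ x∈Far (proj₁ (x∈p∩q⁻ T U x∈T∩U)))) ]′
                     (x∈p∪q⁻ K Far (U⊆K∪Far (proj₂ (x∈p∩q⁻ T U x∈T∩U))))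
    ∣T∩U∣≡s : ∣ T ∩ U ∣ ≡ s
    ∣T∩U∣≡s = trans (≤-antisym (p⊆q⇒∣p∣≤∣q∣ T∩U⊆K) (p⊆q⇒∣p∣≤∣q∣ (λ x∈K → x∈p∩q⁺ (K⊆T x∈K , K⊆U x∈K)))) ∣K∣

  r≤∣∁[W∪W']∣ : ∀ W W' → ∣ W ∣ ≡ r → ∣ W' ∣ ≡ r → ∣ W ─ W' ∣ ≤ d → r ≤ ∣ ∁ (W ∪ W') ∣
  r≤∣∁[W∪W']∣ W W' ∣W∣ ∣W'∣ t≤d = r≤∣∁X∣ (W ∪ W') (begin
    ∣ W ∪ W' ∣          ≡⟨ ∣p∪q∣≡∣p∣+∣q─p∣ W W' ⟩
    ∣ W ∣ + ∣ W' ─ W ∣  ≡⟨ cong₂ _+_ ∣W∣ (∣q─p∣≡∣p─q∣ W W' (trans ∣W∣ (sym ∣W'∣))) ⟩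
    r + ∣ W ─ W' ∣      ≤⟨ +-monoʳ-≤ r t≤d ⟩
    r + d               ∎)
    where open ≤-Reasoning

  Compatible : ℕ → Pair n → Pair n → Set
  Compatible b (g , W) (g' , W') = g ∉ W' × g' ∉ W × ∣ W ─ W' ∣ ≤ b

  module Reach (2≤r : 2 ≤ r) (1≤d : 1 ≤ d) where

    1≤r : 1 ≤ r
    1≤r = ≤-trans (s≤s z≤n) 2≤r

    -- Two vertices whose tails differ in b ≤ min(d, r - 1) elements have a common neighbour:
    -- its head is a shared tail element, its tail lies in ∁ (W ∪ W') (of size ≥ r) and
    -- contains both heads.
    twoStep : ∀ {b g g' W W'} → V (g , W) → V (g' , W') → Compatible b (g , W) (g' , W') →
              b ≤ d → b < r → Walk n r (g , W) (g' , W') 2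
    twoStep {b} {g} {g'} {W} {W'} (∣W∣ , g∉W) (∣W'∣ , g'∉W') (g∉W' , g'∉W , t≤b) b≤d b<r =
      cons (R⊆ g∈R , m∈W , W∩S=∅) (size , m∉S) (cons (m∈W' , R⊆ g'∈R , S∩W'=∅) (∣W'∣ , g'∉W') nil)
      where
      t : ℕ
      t = ∣ W ─ W' ∣
      1≤∣W∩W'∣ : 1 ≤ ∣ W ∩ W' ∣
      1≤∣W∩W'∣ = +-cancelʳ-≤ t 1 _ (≤-trans (≤-trans (s≤s t≤b) b<r)
                   (≤-reflexive (trans (sym ∣W∣) (∣p∣≡∣p∩q∣+∣p─q∣ W W'))))
      common : Nonempty (W ∩ W')
      common = nonempty (W ∩ W') 1≤∣W∩W'∣
      m : Fin n
      m = proj₁ common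
      m∈W : m ∈ W
      m∈W = proj₁ (x∈p∩q⁻ W W' (proj₂ common))
      m∈W' : m ∈ W'
      m∈W' = proj₂ (x∈p∩q⁻ W W' (proj₂ common))
      Out : Subset n
      Out = ∁ (W ∪ W')
      R : Subset n
      R = ⁅ g ⁆ ∪ ⁅ g' ⁆
      R⊆Out : R ⊆ Out
      R⊆Out = ∪⊆ (⁅x⁆⊆ (∉∪⇒∈∁ g∉W g∉W')) (⁅x⁆⊆ (∉∪⇒∈∁ g'∉W g'∉W'))
      ∣R∣≤r : ∣ R ∣ ≤ r
      ∣R∣≤r = ≤-trans (∣p∪q∣≤∣p∣+∣q∣ ⁅ g ⁆ ⁅ g' ⁆)
                (≤-trans (≤-reflexive (cong₂ _+_ (∣⁅x⁆∣≡1 g) (∣⁅x⁆∣≡1 g'))) 2≤r)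
      open Chosen (chooseAround R Out r R⊆Out ∣R∣≤r (r≤∣∁[W∪W']∣ W W' ∣W∣ ∣W'∣ (≤-trans t≤b b≤d)))
        renaming (set to S)
      g∈R : g ∈ R
      g∈R = p⊆p∪q ⁅ g' ⁆ (x∈⁅x⁆ g)
      g'∈R : g' ∈ R
      g'∈R = q⊆p∪q ⁅ g ⁆ ⁅ g' ⁆ (x∈⁅x⁆ g')
      m∉S : m ∉ S
      m∉S m∈S = ∈∁∪⇒∉ˡ (⊆A m∈S) m∈W
      W∩S=∅ : Empty (W ∩ S)
      W∩S=∅ (_ , x∈W∩S) = ∈∁∪⇒∉ˡ (⊆A (proj₂ (x∈p∩q⁻ W S x∈W∩S))) (proj₁ (x∈p∩q⁻ W S x∈W∩S))
      S∩W'=∅ : Empty (S ∩ W')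
      S∩W'=∅ (_ , x∈S∩W') = ∈∁∪⇒∉ʳ (⊆A (proj₁ (x∈p∩q⁻ S W' x∈S∩W'))) (proj₂ (x∈p∩q⁻ S W' x∈S∩W'))

    fresh : ∀ W W' → ∣ W ∣ ≡ r → ∣ W' ∣ ≡ r → ∃ λ c → c ∉ W ∪ W'
    fresh W W' ∣W∣ ∣W'∣ = missing (W ∪ W') (begin-strict
      ∣ W ∪ W' ∣      ≤⟨ ∣p∪q∣≤∣p∣+∣q∣ W W' ⟩
      ∣ W ∣ + ∣ W' ∣  ≡⟨ cong₂ _+_ ∣W∣ ∣W'∣ ⟩
      r + r           <⟨ m<m+n (r + r) 1≤d ⟩
      r + r + d       ∎)
      where open ≤-Reasoning

    record Midpoint (b₁ b₂ : ℕ) (x y : Pair n) : Set where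
      field
        mid        : Pair n
        mid-vertex : V mid
        left       : Compatible b₁ x mid
        right      : Compatible b₂ mid y

    throughMidpoint : ∀ {b₁ b₂ x y} → V x → V y → Midpoint b₁ b₂ x y →
                      b₁ ≤ d → b₁ < r → b₂ ≤ d → b₂ < r → Walk n r x y 4
    throughMidpoint vx vy M b₁≤d b₁<r b₂≤d b₂<r =
      twoStep vx mid-vertex left b₁≤d b₁<r ++ʷ twoStep mid-vertex vy right b₂≤d b₂<r
      where open Midpoint M

    -- Interpolation: if ∣ W ─ W' ∣ = x + y with x, y ≥ 1, the tail (W ∩ W') ∪ X ∪ Y, where
    -- X consists of x elements of W ─ W' and Y of y elements of W' ─ W (avoiding the heads),
    -- is y away from W and x away from W'; its head is any element outside W ∪ W'.
    interpolate : ∀ {g g' W W'} x y → V (g , W) → V (g' , W') → x + y ≡ ∣ W ─ W' ∣ → 1 ≤ x → 1 ≤ y →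
                  Midpoint y x (g , W) (g' , W')
    interpolate {g} {g'} {W} {W'} x y (∣W∣ , g∉W) (∣W'∣ , g'∉W') x+y≡t 1≤x 1≤y = record
      { mid = c , W₁ ; mid-vertex = ∣W₁∣ , c∉W₁
      ; left = g∉W₁ , ∉∪⇒∉ˡ c∉W∪W' , ∣W─W₁∣≤y ; right = ∉∪⇒∉ʳ c∉W∪W' , g'∉W₁ , ∣W₁─W'∣≤x }
      where
      t : ℕ
      t = ∣ W ─ W' ∣
      ∣W'─W∣≡t : ∣ W' ─ W ∣ ≡ t
      ∣W'─W∣≡t = ∣q─p∣≡∣p─q∣ W W' (trans ∣W∣ (sym ∣W'∣))
      x≤ : x ≤ ∣ W ─ W' - g' ∣
      x≤ = +-cancelˡ-≤ 1 x _ (≤-trans (≤-trans (+-monoˡ-≤ x 1≤y) (≤-reflexive (trans (+-comm y x) x+y≡t)))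
                                       (∣p∣≤1+∣p-x∣ (W ─ W') g'))
      y≤ : y ≤ ∣ W' ─ W - g ∣
      y≤ = +-cancelˡ-≤ 1 y _ (≤-trans (≤-trans (+-monoˡ-≤ y 1≤x) (≤-reflexive (trans x+y≡t (sym ∣W'─W∣≡t))))
                                       (∣p∣≤1+∣p-x∣ (W' ─ W) g))
      open Chosen (choose (W ─ W' - g') x x≤) using () renaming (set to X; ⊆A to X⊆; size to ∣X∣)
      open Chosen (choose (W' ─ W - g) y y≤) using () renaming (set to Y; ⊆A to Y⊆; size to ∣Y∣)
      K : Subset n
      K = W ∩ W'
      W₁ : Subset n
      W₁ = K ∪ X ∪ Y
      X⊆W─W' : X ⊆ W ─ W'
      X⊆W─W' x∈X = p─q⊆p (W ─ W') ⁅ g' ⁆ (X⊆ x∈X)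
      Y⊆W'─W : Y ⊆ W' ─ W
      Y⊆W'─W x∈Y = p─q⊆p (W' ─ W) ⁅ g ⁆ (Y⊆ x∈Y)
      parts : ∀ {z} → z ∈ W₁ → z ∈ K ⊎ z ∈ X ⊎ z ∈ Y
      parts z∈W₁ = Sum.map₂ (x∈p∪q⁻ X Y) (x∈p∪q⁻ K (X ∪ Y) z∈W₁)
      K∪X⊆W : ∀ {z} → z ∈ K ⊎ z ∈ X → z ∈ W
      K∪X⊆W (inj₁ z∈K) = proj₁ (x∈p∩q⁻ W W' z∈K)
      K∪X⊆W (inj₂ z∈X) = p─q⊆p W W' (X⊆W─W' z∈X)
      K∪Y⊆W' : ∀ {z} → z ∈ K ⊎ z ∈ Y → z ∈ W'
      K∪Y⊆W' (inj₁ z∈K) = proj₂ (x∈p∩q⁻ W W' z∈K)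
      K∪Y⊆W' (inj₂ z∈Y) = p─q⊆p W' W (Y⊆W'─W z∈Y)
      outsideW'⇒X : ∀ {z} → z ∈ K ⊎ z ∈ X ⊎ z ∈ Y → z ∉ W' → z ∈ X
      outsideW'⇒X (inj₁ z∈K) z∉W' = ⊥-elim (z∉W' (K∪Y⊆W' (inj₁ z∈K)))
      outsideW'⇒X (inj₂ (inj₁ z∈X)) _ = z∈X
      outsideW'⇒X (inj₂ (inj₂ z∈Y)) z∉W' = ⊥-elim (z∉W' (K∪Y⊆W' (inj₂ z∈Y)))
      outsideW⇒Y : ∀ {z} → z ∈ K ⊎ z ∈ X ⊎ z ∈ Y → z ∉ W → z ∈ Y
      outsideW⇒Y (inj₁ z∈K) z∉W = ⊥-elim (z∉W (K∪X⊆W (inj₁ z∈K)))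
      outsideW⇒Y (inj₂ (inj₁ z∈X)) z∉W = ⊥-elim (z∉W (K∪X⊆W (inj₂ z∈X)))
      outsideW⇒Y (inj₂ (inj₂ z∈Y)) _ = z∈Y
      W₁⊆W∪W' : ∀ {z} → z ∈ K ⊎ z ∈ X ⊎ z ∈ Y → z ∈ W ∪ W'
      W₁⊆W∪W' (inj₁ z∈K) = p⊆p∪q W' (K∪X⊆W (inj₁ z∈K))
      W₁⊆W∪W' (inj₂ (inj₁ z∈X)) = p⊆p∪q W' (K∪X⊆W (inj₂ z∈X))
      W₁⊆W∪W' (inj₂ (inj₂ z∈Y)) = q⊆p∪q W W' (K∪Y⊆W' (inj₂ z∈Y))
      g∉Y : g ∉ Y
      g∉Y g∈Y = x∈p─q⇒x∉q (W' ─ W) ⁅ g ⁆ (Y⊆ g∈Y) (x∈⁅x⁆ g)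
      g'∉X : g' ∉ X
      g'∉X g'∈X = x∈p─q⇒x∉q (W ─ W') ⁅ g' ⁆ (X⊆ g'∈X) (x∈⁅x⁆ g')
      g∉W₁ : g ∉ W₁
      g∉W₁ g∈W₁ = g∉Y (outsideW⇒Y (parts g∈W₁) g∉W)
      g'∉W₁ : g' ∉ W₁
      g'∉W₁ g'∈W₁ = g'∉X (outsideW'⇒X (parts g'∈W₁) g'∉W')
      c : Fin n
      c = proj₁ (fresh W W' ∣W∣ ∣W'∣)
      c∉W∪W' : c ∉ W ∪ W'
      c∉W∪W' = proj₂ (fresh W W' ∣W∣ ∣W'∣)
      c∉W₁ : c ∉ W₁
      c∉W₁ c∈W₁ = c∉W∪W' (W₁⊆W∪W' (parts c∈W₁))
      X∌W' : ∀ {z} → z ∈ X → z ∉ W'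
      X∌W' z∈X = x∈p─q⇒x∉q W W' (X⊆W─W' z∈X)
      Y∌W : ∀ {z} → z ∈ Y → z ∉ W
      Y∌W z∈Y = x∈p─q⇒x∉q W' W (Y⊆W'─W z∈Y)
      K∩[X∪Y]=∅ : Empty (K ∩ (X ∪ Y))
      K∩[X∪Y]=∅ (_ , z∈) = let z∈K , z∈X∪Y = x∈p∩q⁻ K (X ∪ Y) z∈ in [ (λ z∈X → X∌W' z∈X (K∪Y⊆W' (inj₁ z∈K))) , (λ z∈Y → Y∌W z∈Y (K∪X⊆W (inj₁ z∈K))) ]′
                             (x∈p∪q⁻ X Y z∈X∪Y)
      X∩Y=∅ : Empty (X ∩ Y)
      X∩Y=∅ (_ , z∈X∩Y) = Y∌W (proj₂ (x∈p∩q⁻ X Y z∈X∩Y)) (K∪X⊆W (inj₂ (proj₁ (x∈p∩q⁻ X Y z∈X∩Y))))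
      ∣W₁∣ : ∣ W₁ ∣ ≡ r
      ∣W₁∣ = begin
        ∣ K ∪ X ∪ Y ∣           ≡⟨ ∣p∪q∣≡∣p∣+∣q∣ K (X ∪ Y) K∩[X∪Y]=∅ ⟩
        ∣ K ∣ + ∣ X ∪ Y ∣       ≡⟨ cong (∣ K ∣ +_) (∣p∪q∣≡∣p∣+∣q∣ X Y X∩Y=∅) ⟩
        ∣ K ∣ + (∣ X ∣ + ∣ Y ∣) ≡⟨ cong (∣ K ∣ +_) (trans (cong₂ _+_ ∣X∣ ∣Y∣) x+y≡t) ⟩
        ∣ K ∣ + t               ≡⟨ ∣p∣≡∣p∩q∣+∣p─q∣ W W' ⟨
        ∣ W ∣                   ≡⟨ ∣W∣ ⟩
        r                       ∎
        where open ≡-Reasoning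
      ∣W₁─W'∣≤x : ∣ W₁ ─ W' ∣ ≤ x
      ∣W₁─W'∣≤x = ≤-trans (p⊆q⇒∣p∣≤∣q∣ (λ z∈ → outsideW'⇒X (parts (p─q⊆p W₁ W' z∈)) (x∈p─q⇒x∉q W₁ W' z∈)))
                          (≤-reflexive ∣X∣)
      ∣W─W₁∣≤y : ∣ W ─ W₁ ∣ ≤ y
      ∣W─W₁∣≤y = begin
        ∣ W ─ W₁ ∣   ≡⟨ ∣q─p∣≡∣p─q∣ W₁ W (trans ∣W₁∣ (sym ∣W∣)) ⟩
        ∣ W₁ ─ W ∣   ≤⟨ p⊆q⇒∣p∣≤∣q∣ (λ z∈ → outsideW⇒Y (parts (p─q⊆p W₁ W z∈)) (x∈p─q⇒x∉q W₁ W z∈)) ⟩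
        ∣ Y ∣        ≡⟨ ∣Y∣ ⟩
        y            ∎
        where open ≤-Reasoning

    -- Tails W = K ∪ ⁅ g' ⁆ and W' = K ∪ ⁅ g ⁆ whose heads are crossed: route through the tail
    -- K ∪ ⁅ e ⁆ with a head c, where e ≠ c both lie outside W ∪ W'.
    crossedMidpoint : ∀ {g g' W W'} → V (g , W) → V (g' , W') → ∣ W ─ W' ∣ ≤ 1 → g ∈ W' → g' ∈ W →
                      Midpoint 1 1 (g , W) (g' , W')
    crossedMidpoint {g} {g'} {W} {W'} (∣W∣ , g∉W) (∣W'∣ , g'∉W') t≤1 g∈W' g'∈W = record
      { mid = c , W₁ ; mid-vertex = ∣W₁∣ , c∉W₁
      ; left = g∉W₁ , ∈∁∪⇒∉ˡ c∈Out , ∣W─W₁∣≤1 ; right = ∈∁∪⇒∉ʳ c∈Out , g'∉W₁ , ∣W₁─W'∣≤1 }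
      where
      K : Subset n
      K = W ∩ W'
      Out : Subset n
      Out = ∁ (W ∪ W')
      t≡1 : ∣ W ─ W' ∣ ≡ 1
      t≡1 = ≤-antisym t≤1 (x∈p⇒1≤∣p∣ (x∈p∧x∉q⇒x∈p─q g'∈W g'∉W'))
      2≤∣Out∣ : 2 ≤ ∣ Out ∣
      2≤∣Out∣ = ≤-trans 2≤r (r≤∣∁[W∪W']∣ W W' ∣W∣ ∣W'∣ (≤-trans t≤1 1≤d))
      e : Fin n
      e = proj₁ (nonempty Out (≤-trans (s≤s z≤n) 2≤∣Out∣))
      e∈Out : e ∈ Out
      e∈Out = proj₂ (nonempty Out (≤-trans (s≤s z≤n) 2≤∣Out∣))
      c : Fin n
      c = proj₁ (nonempty (Out - e) (≤-pred (≤-trans 2≤∣Out∣ (∣p∣≤1+∣p-x∣ Out e))))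
      c∈Out-e : c ∈ Out - e
      c∈Out-e = proj₂ (nonempty (Out - e) (≤-pred (≤-trans 2≤∣Out∣ (∣p∣≤1+∣p-x∣ Out e))))
      c∈Out : c ∈ Out
      c∈Out = p─q⊆p Out ⁅ e ⁆ c∈Out-e
      ∉⁅e⁆ : ∀ {z} → z ∈ W ⊎ z ∈ W' → z ∉ ⁅ e ⁆
      ∉⁅e⁆ z∈W∪W' z∈⁅e⁆ = x∈∁p⇒x∉p e∈Out (subst (_∈ W ∪ W') (x∈⁅y⁆⇒x≡y e z∈⁅e⁆) (x∈p∪q⁺ z∈W∪W'))
      W₁ : Subset n
      W₁ = K ∪ ⁅ e ⁆
      K∌ : ∀ {z} → z ∉ W ⊎ z ∉ W' → z ∉ K
      K∌ (inj₁ z∉W) z∈K = z∉W (proj₁ (x∈p∩q⁻ W W' z∈K))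
      K∌ (inj₂ z∉W') z∈K = z∉W' (proj₂ (x∈p∩q⁻ W W' z∈K))
      K∩⁅e⁆=∅ : Empty (K ∩ ⁅ e ⁆)
      K∩⁅e⁆=∅ (_ , z∈K∩⁅e⁆) = ∉⁅e⁆ (inj₁ (proj₁ (x∈p∩q⁻ W W' (proj₁ (x∈p∩q⁻ K ⁅ e ⁆ z∈K∩⁅e⁆)))))
                                  (proj₂ (x∈p∩q⁻ K ⁅ e ⁆ z∈K∩⁅e⁆))
      ∣W₁∣ : ∣ W₁ ∣ ≡ r
      ∣W₁∣ = begin
        ∣ K ∪ ⁅ e ⁆ ∣       ≡⟨ ∣p∪q∣≡∣p∣+∣q∣ K ⁅ e ⁆ K∩⁅e⁆=∅ ⟩
        ∣ K ∣ + ∣ ⁅ e ⁆ ∣   ≡⟨ cong (∣ K ∣ +_) (trans (∣⁅x⁆∣≡1 e) (sym t≡1)) ⟩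
        ∣ K ∣ + ∣ W ─ W' ∣  ≡⟨ ∣p∣≡∣p∩q∣+∣p─q∣ W W' ⟨
        ∣ W ∣               ≡⟨ ∣W∣ ⟩
        r                   ∎
        where open ≡-Reasoning
      c∉W₁ : c ∉ W₁
      c∉W₁ = x∉p∪q (K∌ (inj₁ (∈∁∪⇒∉ˡ c∈Out))) (x∈p─q⇒x∉q Out ⁅ e ⁆ c∈Out-e)
      g∉W₁ : g ∉ W₁
      g∉W₁ = x∉p∪q (K∌ (inj₁ g∉W)) (∉⁅e⁆ (inj₂ g∈W'))
      g'∉W₁ : g' ∉ W₁
      g'∉W₁ = x∉p∪q (K∌ (inj₂ g'∉W')) (∉⁅e⁆ (inj₁ g'∈W))
      ∣W─W₁∣≤1 : ∣ W ─ W₁ ∣ ≤ 1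
      ∣W─W₁∣≤1 = ≤-trans (p⊆q⇒∣p∣≤∣q∣ W─W₁⊆W─W') t≤1
        where
        W─W₁⊆W─W' : W ─ W₁ ⊆ W ─ W'
        W─W₁⊆W─W' z∈ = x∈p∧x∉q⇒x∈p─q (p─q⊆p W W₁ z∈)
          (λ z∈W' → x∈p─q⇒x∉q W W₁ z∈ (p⊆p∪q ⁅ e ⁆ (x∈p∩q⁺ (p─q⊆p W W₁ z∈ , z∈W'))))
      ∣W₁─W'∣≤1 : ∣ W₁ ─ W' ∣ ≤ 1
      ∣W₁─W'∣≤1 = ≤-trans (p⊆q⇒∣p∣≤∣q∣ W₁─W'⊆⁅e⁆) (≤-reflexive (∣⁅x⁆∣≡1 e))
        where
        W₁─W'⊆⁅e⁆ : W₁ ─ W' ⊆ ⁅ e ⁆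
        W₁─W'⊆⁅e⁆ z∈ = [ (λ z∈K → ⊥-elim (x∈p─q⇒x∉q W₁ W' z∈ (proj₂ (x∈p∩q⁻ W W' z∈K)))) , (λ z∈⁅e⁆ → z∈⁅e⁆) ]′
                          (x∈p∪q⁻ K ⁅ e ⁆ (p─q⊆p W₁ W' z∈))

    ∣p─p∣≤1 : (p : Subset n) → ∣ p ─ p ∣ ≤ 1
    ∣p─p∣≤1 p = ≤-trans (≤-reflexive (∣p─p∣≡0 p)) z≤n

    -- Tails differing in at most one element: route through a fresh head on W' if g ∉ W',
    -- on W if g' ∉ W, and through the crossed construction otherwise.
    closeMidpoint : ∀ {g g' W W'} → V (g , W) → V (g' , W') → ∣ W ─ W' ∣ ≤ 1 → Midpoint 1 1 (g , W) (g' , W')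
    closeMidpoint {g} {g'} {W} {W'} vx vy t≤1 with g ∈? W' | g' ∈? W
    ... | no g∉W' | _ = record
      { mid = c , W' ; mid-vertex = proj₁ vy , ∉∪⇒∉ʳ c∉W∪W'
      ; left = g∉W' , ∉∪⇒∉ˡ c∉W∪W' , t≤1 ; right = ∉∪⇒∉ʳ c∉W∪W' , proj₂ vy , ∣p─p∣≤1 W' }
      where open Σ (fresh W W' (proj₁ vx) (proj₁ vy)) renaming (proj₁ to c; proj₂ to c∉W∪W')
    ... | yes _ | no g'∉W = record
      { mid = c , W ; mid-vertex = proj₁ vx , ∉∪⇒∉ˡ c∉W∪W'
      ; left = proj₂ vx , ∉∪⇒∉ˡ c∉W∪W' , ∣p─p∣≤1 W ; right = ∉∪⇒∉ʳ c∉W∪W' , g'∉W , t≤1 }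
      where open Σ (fresh W W' (proj₁ vx) (proj₁ vy)) renaming (proj₁ to c; proj₂ to c∉W∪W')
    ... | yes g∈W' | yes g'∈W = crossedMidpoint vx vy t≤1 g∈W' g'∈W

    -- Tails differing in at most 2d elements: distance at most 4.  For t = ∣ W ─ W' ∣ ≥ 2 the
    -- interpolation splits t into ⌈t/2⌉ + ⌊t/2⌋, both between 1 and min(d, r - 1).
    nearWalk : ∀ {g g' W W'} → V (g , W) → V (g' , W') → ∣ W ─ W' ∣ ≤ d + d → Walk n r (g , W) (g' , W') 4
    nearWalk {W = W} {W'} vx vy t≤2d with ∣ W ─ W' ∣ ≤? 1
    ... | yes t≤1 = throughMidpoint vx vy (closeMidpoint vx vy t≤1) 1≤d 2≤r 1≤d 2≤r
    ... | no t≰1 = throughMidpoint vx vy (interpolate ⌈ t /2⌉ ⌊ t /2⌋ vx vy x+y≡t 1≤x 1≤y)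
                     (≤-trans y≤x x≤d) (≤-<-trans y≤x x<r) x≤d x<r
      where
      t : ℕ
      t = ∣ W ─ W' ∣
      x+y≡t : ⌈ t /2⌉ + ⌊ t /2⌋ ≡ t
      x+y≡t = trans (+-comm ⌈ t /2⌉ _) (⌊n/2⌋+⌈n/2⌉≡n t)
      1≤y : 1 ≤ ⌊ t /2⌋
      1≤y = ⌊n/2⌋-mono (≰⇒> t≰1)
      y≤x : ⌊ t /2⌋ ≤ ⌈ t /2⌉
      y≤x = ⌊n/2⌋≤⌈n/2⌉ t
      1≤x : 1 ≤ ⌈ t /2⌉
      1≤x = ≤-trans 1≤y y≤x
      x≤d : ⌈ t /2⌉ ≤ d
      x≤d = subst (⌈ t /2⌉ ≤_) (sym (n≡⌈n+n/2⌉ d)) (⌈n/2⌉-mono t≤2d)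
      x<r : ⌈ t /2⌉ < r
      x<r = <-≤-trans (subst (⌈ t /2⌉ <_) x+y≡t (m<m+n ⌈ t /2⌉ 1≤y))
                      (≤-trans (∣p─q∣≤∣p∣ W W') (≤-reflexive (proj₁ vx)))

    -- For t = ∣ W ─ W' ∣ > d, interpolation with y = d gives a two-step walk to a vertex whose
    -- tail is only t - d away from W'.
    approach : ∀ {g g' W W'} → V (g , W) → V (g' , W') → d < ∣ W ─ W' ∣ →
               Σ (Pair n) λ z → V z × Walk n r (g , W) z 2 × ∣ proj₂ z ─ W' ∣ ≤ ∣ W ─ W' ∣ ∸ d
    approach {W = W} {W'} vx vy d<t =
      mid , mid-vertex , twoStep vx mid-vertex left ≤-refl d<r , proj₂ (proj₂ right)
      where
      t : ℕ
      t = ∣ W ─ W' ∣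
      x+d≡t : t ∸ d + d ≡ t
      x+d≡t = m∸n+n≡m (<⇒≤ d<t)
      open Midpoint (interpolate (t ∸ d) d vx vy x+d≡t (m<n⇒0<n∸m d<t) 1≤d)
      d<r : d < r
      d<r = <-≤-trans (subst (d <_) (trans (+-comm d _) x+d≡t) (m<m+n d (m<n⇒0<n∸m d<t)))
                      (≤-trans (∣p─q∣≤∣p∣ W W') (≤-reflexive (proj₁ vx)))

    EvenBound : ℕ → Set
    EvenBound k = ∀ {g g' W W'} → V (g , W) → V (g' , W') → ∣ W ─ W' ∣ ≤ k * d → DistLe n r (g , W) (g' , W') (2 * k)

    -- Induction step: a difference above k d is first reduced by d via approach (two steps).
    evenStep : ∀ k → 1 ≤ k → EvenBound k → EvenBound (suc k)
    evenStep k 1≤k bound {W = W} {W'} vx vy t≤ with ∣ W ─ W' ∣ ≤? k * d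
    ... | yes t≤' = DistLe-weaken (*-monoʳ-≤ 2 (n≤1+n k)) (bound vx vy t≤')
    ... | no t≰ = let z , vz , walk , closer = approach vx vy (<-≤-trans (s≤s (d≤k*d d 1≤k)) (≰⇒> t≰)) in
      subst (DistLe n r _ _) (sym (*-suc 2 k))
            (DistLe-prepend walk (bound vz vy (≤-trans closer (m≤n+o⇒m∸n≤o ∣ W ─ W' ∣ d t≤))))

    evenDistance : ∀ k → 2 ≤ k → EvenBound k
    evenDistance zero ()
    evenDistance (suc zero) (s≤s ())
    evenDistance (suc (suc zero)) _ {W = W} {W'} vx vy t≤2d =
      4 , ≤-refl , nearWalk vx vy (subst (∣ W ─ W' ∣ ≤_) (cong (d +_) (+-identityʳ d)) t≤2d)
    evenDistance (suc (suc (suc k))) _ =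
      evenStep (suc (suc k)) (s≤s z≤n) (evenDistance (suc (suc k)) (s≤s (s≤s z≤n)))

    record Toward (h : Fin n) (T U : Subset n) : Set where
      field
        a      : Fin n
        A      : Subset n
        edge   : Adj (h , T) (a , A)
        vertex : V (a , A)
        closer : ∣ A ─ U ∣ ≤ ∣ T ∩ U ∣ ⊔ 1

    towardVia : ∀ {h T U} → V (h , T) → (R : Subset n) → R ⊆ ∁ T → ∣ R ∣ ≤ r → h ∈ R →
                (∀ {A} → R ⊆ A → ∣ A ∣ ≡ r → ∣ A ─ U ∣ ≤ ∣ T ∩ U ∣ ⊔ 1) → Toward h T U
    towardVia {h} {T} (∣T∣ , h∉T) R R⊆∁T ∣R∣≤r h∈R close = record
      { a = a ; A = A ; edge = R⊆A h∈R , a∈T , T∩A=∅ ; vertex = ∣A∣ , a∉A ; closer = close R⊆A ∣A∣ }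
      where
      a : Fin n
      a = proj₁ (nonempty T (subst (1 ≤_) (sym ∣T∣) 1≤r))
      a∈T : a ∈ T
      a∈T = proj₂ (nonempty T (subst (1 ≤_) (sym ∣T∣) 1≤r))
      r≤∣∁T∣ : r ≤ ∣ ∁ T ∣
      r≤∣∁T∣ = ≤-trans (m≤m+n r d) (≤-reflexive (sym (∣∁X∣≡r+d T ∣T∣)))
      open Chosen (chooseAround R (∁ T) r R⊆∁T ∣R∣≤r r≤∣∁T∣)
        renaming (set to A; R⊆ to R⊆A; ⊆A to A⊆∁T; size to ∣A∣)
      a∉A : a ∉ A
      a∉A a∈A = x∈∁p⇒x∉p (A⊆∁T a∈A) a∈T
      T∩A=∅ : Empty (T ∩ A)
      T∩A=∅ (_ , z∈T∩A) = x∈∁p⇒x∉p (A⊆∁T (proj₂ (x∈p∩q⁻ T A z∈T∩A))) (proj₁ (x∈p∩q⁻ T A z∈T∩A))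

    -- With P = (U ─ T) - h: if ∣ P ∣ ≥ r - 1, put h and r - 1 elements of P ⊆ U into the new
    -- tail, which then misses U at most once; otherwise put h and all of P, so the new tail
    -- contains U ─ T and misses U at most ∣ U ∩ T ∣ times.
    stepToward : ∀ {h T U} → V (h , T) → ∣ U ∣ ≡ r → Toward h T U
    stepToward {h} {T} {U} vx ∣U∣ = byCase (r ∸ 1 ≤? ∣ P ∣)
      where
      P : Subset n
      P = U ─ T - h
      ⁅h⁆⊆∁T : ⁅ h ⁆ ⊆ ∁ T
      ⁅h⁆⊆∁T = ⁅x⁆⊆ (x∉p⇒x∈∁p (proj₂ vx))
      P⊆∁T : P ⊆ ∁ T
      P⊆∁T z∈P = x∉p⇒x∈∁p (x∈p─q⇒x∉q U T (p─q⊆p (U ─ T) ⁅ h ⁆ z∈P))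
      byCase : Dec (r ∸ 1 ≤ ∣ P ∣) → Toward h T U
      byCase (yes enough) = towardVia vx (⁅ h ⁆ ∪ P') (∪⊆ ⁅h⁆⊆∁T (λ z∈P' → P⊆∁T (P'⊆P z∈P'))) ∣R∣≤r
                                      (p⊆p∪q P' (x∈⁅x⁆ h)) close
        where
        open Chosen (choose P (r ∸ 1) enough) using () renaming (set to P'; ⊆A to P'⊆P; size to ∣P'∣)
        ∣R∣≤r : ∣ ⁅ h ⁆ ∪ P' ∣ ≤ r
        ∣R∣≤r = ≤-trans (∣p∪q∣≤∣p∣+∣q∣ ⁅ h ⁆ P') (≤-reflexive (trans (cong₂ _+_ (∣⁅x⁆∣≡1 h) ∣P'∣) (m+[n∸m]≡n 1≤r)))
        close : ∀ {A} → ⁅ h ⁆ ∪ P' ⊆ A → ∣ A ∣ ≡ r → ∣ A ─ U ∣ ≤ ∣ T ∩ U ∣ ⊔ 1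
        close {A} R⊆A ∣A∣ = ≤-trans (+-cancelʳ-≤ (r ∸ 1) ∣ A ─ U ∣ 1 (begin
          ∣ A ─ U ∣ + (r ∸ 1)   ≡⟨ cong (∣ A ─ U ∣ +_) ∣P'∣ ⟨
          ∣ A ─ U ∣ + ∣ P' ∣    ≤⟨ ∣A─U∣+∣Q∣≤∣A∣ P'⊆A∩U ⟩
          ∣ A ∣                 ≡⟨ trans ∣A∣ (sym (m+[n∸m]≡n 1≤r)) ⟩
          1 + (r ∸ 1)           ∎)) (m≤n⊔m ∣ T ∩ U ∣ 1)
          where
          open ≤-Reasoning
          P'⊆A∩U : P' ⊆ A ∩ U
          P'⊆A∩U z∈P' = x∈p∩q⁺ (R⊆A (q⊆p∪q ⁅ h ⁆ P' z∈P') , p─q⊆p U T (p─q⊆p (U ─ T) ⁅ h ⁆ (P'⊆P z∈P')))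
      byCase (no few) = towardVia vx (⁅ h ⁆ ∪ P) (∪⊆ ⁅h⁆⊆∁T P⊆∁T) ∣R∣≤r (p⊆p∪q P (x∈⁅x⁆ h)) close
        where
        ∣R∣≤r : ∣ ⁅ h ⁆ ∪ P ∣ ≤ r
        ∣R∣≤r = ≤-trans (∣p∪q∣≤∣p∣+∣q∣ ⁅ h ⁆ P)
                  (≤-trans (≤-reflexive (cong (_+ ∣ P ∣) (∣⁅x⁆∣≡1 h)))
                    (≤-trans (s≤s (<⇒≤ (≰⇒> few))) (≤-reflexive (m+[n∸m]≡n 1≤r))))
        close : ∀ {A} → ⁅ h ⁆ ∪ P ⊆ A → ∣ A ∣ ≡ r → ∣ A ─ U ∣ ≤ ∣ T ∩ U ∣ ⊔ 1
        close {A} R⊆A ∣A∣ = ≤-trans (+-cancelʳ-≤ ∣ U ─ T ∣ ∣ A ─ U ∣ _ (begin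
          ∣ A ─ U ∣ + ∣ U ─ T ∣       ≤⟨ ∣A─U∣+∣Q∣≤∣A∣ U─T⊆A∩U ⟩
          ∣ A ∣                       ≡⟨ trans ∣A∣ (sym ∣U∣) ⟩
          ∣ U ∣                       ≡⟨ ∣p∣≡∣p∩q∣+∣p─q∣ U T ⟩
          ∣ U ∩ T ∣ + ∣ U ─ T ∣       ≡⟨ cong (λ S → ∣ S ∣ + ∣ U ─ T ∣) (∩-comm U T) ⟩
          ∣ T ∩ U ∣ + ∣ U ─ T ∣       ∎)) (m≤m⊔n ∣ T ∩ U ∣ 1)
          where
          open ≤-Reasoning
          U─T⊆A∩U : U ─ T ⊆ A ∩ U
          U─T⊆A∩U z∈U─T = x∈p∩q⁺ (R⊆A (p⊆⁅x⁆∪[p-x] (U ─ T) h z∈U─T) , p─q⊆p U T z∈U─T)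

    oddDistance : ∀ {h T k' U} k → 2 ≤ k → V (h , T) → V (k' , U) → ∣ T ∩ U ∣ ≤ k * d →
                  DistLe n r (h , T) (k' , U) (suc (2 * k))
    oddDistance {U = U} k 2≤k vx vy s≤kd =
      DistLe-prepend (cons edge vertex nil)
        (evenDistance k 2≤k vertex vy (≤-trans closer (⊔-lub s≤kd (≤-trans 1≤d (d≤k*d d (≤-trans (s≤s z≤n) 2≤k))))))
      where open Toward (stepToward {U = U} vx (proj₁ vy))

positiveHalf : ∀ d → 1 ≤ d + d → 1 ≤ d
positiveHalf (suc d) _ = s≤s z≤n

diameter-large : ∀ r d → 2 ≤ r → r ≤ d + d → Diameter (r + r + d) r 4
diameter-large r d 2≤r r≤2d =
  upper , (head , tail₁) , (head , tail₂) , vertex₁ , vertex₂ ,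
  λ _ → sameHeadFar 1≤r vertex₁ vertex₂ (∣p∣≡0⇒Empty shared)
  where
  open Graph r d
  1≤d : 1 ≤ d
  1≤d = positiveHalf d (≤-trans (s≤s z≤n) (≤-trans 2≤r r≤2d))
  open Reach 2≤r 1≤d
  open SameHeadPair (sameHeadPair 1≤d 0 z≤n)
  upper : ∀ x y → V x → V y → DistLe n r x y 4
  upper (_ , W) (_ , W') vx vy = evenDistance 2 ≤-refl vx vy
    (≤-trans (∣p─q∣≤∣p∣ W W') (≤-trans (≤-reflexive (proj₁ vx)) (subst (r ≤_) (cong (d +_) (sym (+-identityʳ d))) r≤2d)))

-- Middle range 2d < r: with q = ⌈(r - 1)/d⌉ every pair has either small difference or small
-- overlap, giving distance at most max(5, q + 1).
middle-upper : ∀ r d → 2 ≤ r → 1 ≤ d → ∀ x y → IsVertex (r + r + d) r x → IsVertex (r + r + d) r y →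
               DistLe (r + r + d) r x y (5 ⊔ (ceilDiv (r ∸ 1) d + 1))
middle-upper r d 2≤r 1≤d (_ , T) (_ , U) vx vy =
  [ (λ t≤ed → DistLe-weaken (evenLength q)
       (evenDistance (2 ⊔ ⌈ q /2⌉) (m≤m⊔n 2 ⌈ q /2⌉) vx vy (≤-trans t≤ed (*-monoˡ-≤ d (m≤n⊔m 2 ⌈ q /2⌉)))))
  , (λ s≤od → DistLe-weaken (oddLength q)
       (oddDistance (2 ⊔ ⌊ q /2⌋) (m≤m⊔n 2 ⌊ q /2⌋) vx vy (≤-trans s≤od (*-monoˡ-≤ d (m≤n⊔m 2 ⌊ q /2⌋)))))
  ]′ (evenOrOdd q d ∣ T ∩ U ∣ ∣ T ─ U ∣ s+t≤qd+1)
  where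
  open Graph r d
  open Reach 2≤r 1≤d
  q : ℕ
  q = ceilDiv (r ∸ 1) d
  s+t≤qd+1 : ∣ T ∩ U ∣ + ∣ T ─ U ∣ ≤ q * d + 1
  s+t≤qd+1 = subst (_≤ q * d + 1) (trans (m∸n+n≡m 1≤r) (trans (sym (proj₁ vx)) (∣p∣≡∣p∩q∣+∣p─q∣ T U)))
                   (+-monoˡ-≤ 1 (ceilDiv-upper (r ∸ 1) d 1≤d))

FarPair : ℕ → ℕ → ℕ → Set
FarPair n r m = ∃ λ x → ∃ λ y → IsVertex n r x × IsVertex n r y × (∀ k → Walk n r x y k → m ≤ k)

FarPair-weaken : ∀ {n r m m'} → m' ≤ m → FarPair n r m → FarPair n r m'
FarPair-weaken m'≤m (x , y , vx , vy , far) = x , y , vx , vy , λ k walk → ≤-trans m'≤m (far k walk)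

-- Middle range, first lower bound: a common head with disjoint tails is at distance at least 5,
-- since a walk of length 4 would force r = ∣ T ─ U ∣ ≤ 2d.
farAt5 : ∀ r d → 2 ≤ r → 1 ≤ d → d + d < r → FarPair (r + r + d) r 5
farAt5 r d 2≤r 1≤d 2d<r = (head , tail₁) , (head , tail₂) , vertex₁ , vertex₂ , five≤
  where
  open Graph r d
  open Reach 2≤r 1≤d
  open SameHeadPair (sameHeadPair 1≤d 0 z≤n)
  r≡∣T─U∣ : r ≡ ∣ tail₁ ─ tail₂ ∣
  r≡∣T─U∣ = trans (sym (proj₁ vertex₁)) (trans (∣p∣≡∣p∩q∣+∣p─q∣ tail₁ tail₂) (cong (_+ ∣ tail₁ ─ tail₂ ∣) shared))
  five≤ : ∀ k → Walk n r (head , tail₁) (head , tail₂) k → 5 ≤ k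
  five≤ k walk = ≤∧≢⇒< (sameHeadFar 1≤r vertex₁ vertex₂ (∣p∣≡0⇒Empty shared) walk) λ 4≡k →
    <⇒≱ 2d<r (subst (r ≤_) (cong (d +_) (+-identityʳ d))
                (subst (_≤ 2 * d) (sym r≡∣T─U∣)
                  (evenWalkBound 2 (proj₁ vertex₁) (proj₁ vertex₂) (subst (Walk n r _ _) (sym 4≡k) walk))))

-- Middle range, second lower bound: with o = ⌊q/2⌋ and a + 1 = ⌈q/2⌉, a common head with tails
-- sharing a d + 1 elements (so differing in more than o d) is at distance at least q + 1.
farAtQ : ∀ r d → 2 ≤ r → 1 ≤ d → 1 ≤ ⌈ ceilDiv (r ∸ 1) d /2⌉ → FarPair (r + r + d) r (ceilDiv (r ∸ 1) d + 1)
farAtQ r d 2≤r 1≤d 1≤e = (head , tail₁) , (head , tail₂) , vertex₁ , vertex₂ ,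
  λ _ → walkLength≥ (q + 1) a o (proj₁ vertex₁) (proj₁ vertex₂) od<t ad<s
                    (proj₁ (lowerLengths q a e≡1+a)) (proj₂ (lowerLengths q a e≡1+a))
  where
  open Graph r d
  open Reach 2≤r 1≤d
  q : ℕ
  q = ceilDiv (r ∸ 1) d
  o : ℕ
  o = ⌊ q /2⌋
  a : ℕ
  a = ⌈ q /2⌉ ∸ 1
  e≡1+a : ⌈ q /2⌉ ≡ suc a
  e≡1+a = sym (m+[n∸m]≡n 1≤e)
  room : o * d + (a * d + 1) < r
  room = overlapRoom o a d r 1≤r
    (subst (λ m → m * d < r ∸ 1 + d) (trans (sym (⌊n/2⌋+⌈n/2⌉≡n q)) (cong (o +_) e≡1+a))
           (ceilDiv-lower (r ∸ 1) d 1≤d))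
  open SameHeadPair (sameHeadPair 1≤d (a * d + 1) (≤-trans (m≤n+m _ (o * d)) (<⇒≤ room)))
  ad<s : a * d < ∣ tail₁ ∩ tail₂ ∣
  ad<s = subst (a * d <_) (sym shared) (m<m+n (a * d) (s≤s z≤n))
  od<t : o * d < ∣ tail₁ ─ tail₂ ∣
  od<t = +-cancelʳ-< (a * d + 1) (o * d) _ (begin-strict
    o * d + (a * d + 1)                   <⟨ room ⟩
    r                                     ≡⟨ trans (sym (proj₁ vertex₁)) (∣p∣≡∣p∩q∣+∣p─q∣ tail₁ tail₂) ⟩
    ∣ tail₁ ∩ tail₂ ∣ + ∣ tail₁ ─ tail₂ ∣ ≡⟨ cong (_+ ∣ tail₁ ─ tail₂ ∣) shared ⟩
    a * d + 1 + ∣ tail₁ ─ tail₂ ∣         ≡⟨ +-comm (a * d + 1) _ ⟩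
    ∣ tail₁ ─ tail₂ ∣ + (a * d + 1)       ∎)
    where open ≤-Reasoning

diameter-middle : ∀ r d → 2 ≤ r → 1 ≤ d → d + d < r → Diameter (r + r + d) r (5 ⊔ (ceilDiv (r ∸ 1) d + 1))
diameter-middle r d 2≤r 1≤d 2d<r with ceilDiv (r ∸ 1) d + 1 ≤? 5
... | yes q+1≤5 = middle-upper r d 2≤r 1≤d ,
                  FarPair-weaken (⊔-lub ≤-refl q+1≤5) (farAt5 r d 2≤r 1≤d 2d<r)
... | no q+1≰5 = middle-upper r d 2≤r 1≤d ,
                 FarPair-weaken (⊔-lub (<⇒≤ (≰⇒> q+1≰5)) ≤-refl) (farAtQ r d 2≤r 1≤d 1≤e)
  where
  q : ℕ
  q = ceilDiv (r ∸ 1) d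
  1≤e : 1 ≤ ⌈ q /2⌉
  1≤e = ≤-trans (s≤s z≤n) (⌈n/2⌉-mono (≤-pred (≤-trans (≰⇒> q+1≰5) (≤-reflexive (+-comm q 1)))))

mainTheorem1 : (n r : ℕ) → 2 ≤ r →
    ((5 * r ≤ 2 * n → Diameter n r 4) ×
     (2 * r + 1 ≤ n → 2 * n < 5 * r → Diameter n r (5 ⊔ (ceilDiv (r ∸ 1) (n ∸ 2 * r) + 1))))
mainTheorem1 n r 2≤r = large , middle
  where
  d : ℕ
  d = n ∸ 2 * r
  large : 5 * r ≤ 2 * n → Diameter n r 4
  large 5r≤2n =
    let 2r≤n , r≤2d = large-range n r 5r≤2n in
    subst (λ m → Diameter m r 4) (sym (n≡r+r+[n∸2r] n r 2r≤n)) (diameter-large r d 2≤r r≤2d)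
  middle : 2 * r + 1 ≤ n → 2 * n < 5 * r → Diameter n r (5 ⊔ (ceilDiv (r ∸ 1) d + 1))
  middle 2r+1≤n 2n<5r =
    let 2r≤n , 1≤d , 2d<r = middle-range n r 2r+1≤n 2n<5r in
    subst (λ m → Diameter m r (5 ⊔ (ceilDiv (r ∸ 1) d + 1))) (sym (n≡r+r+[n∸2r] n r 2r≤n))
          (diameter-middle r d 2≤r 1≤d 2d<r)
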